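{- Let $G$ be a group given by a presentation $\langle X\mid R\rangle$ with reversible relations. Let $U$ be a length-$\ell$ factorization of elements of $G$, and let $V$ be a double reverse of $U$. Then $U$ and $V$ have Hurwitz orbits of the same size.
   Context: $X=\{x_1,\ldots,x_n\}$, $F(X)$ is the free group on $X$ (reduced words on $X\cup X^{ -1}$), and $\langle X\mid R\rangle$ with $R\subset F(X)$ presents $G\cong F(X)/N$, $N$ the normal closure of $R$ in $F(X)$. For $a=x_{i_1}\cdots x_{i_p}\in F(X)$ with letters in $X\cup X^{ -1}$, the reverse is $a^*=x_{i_p}\cdots x_{i_1}$. The presentation has reversible relations if $r^*\in N$ for every $r\in R$. A factorization is a tuple of elements of $G$; two length-$\ell$ factorizations $U,V$ are double reverses if there exist $a_1,\ldots,a_\ell\in F(X)$ with $U=(a_1,\ldots,a_\ell)$ and $V=(a_\ell^*,\ldots,a_1^*)$ (entries taken as elements of $G$). For $1\le i\le\ell-1$, the Hurwitz move $\sigma_i$ sends $(x_1,\ldots,x_i,x_{i+1},\ldots,x_\ell)$ to $(x_1,\ldots,x_{i+1},x_{i+1}^{ -1}x_ix_{i+1},\ldots,x_\ell)$, with inverse $\sigma_i^{ -1}$ sending it to $(x_1,\ldots,x_ix_{i+1}x_i^{ -1},x_i,\ldots,x_\ell)$. The Hurwitz orbit of a factorization is the set of factorizations obtainable from it by finite sequences of Hurwitz moves and their inverses; its size is its cardinality. -}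

module Defs where

open import Data.Nat using (ℕ; suc)
open import Data.Fin using (Fin)
open import Data.Bool using (Bool; true; false; not)
open import Data.Bool.Properties using (not-involutive)
open import Data.Product using (Σ; _×_; _,_; proj₁)
open import Data.List using (List; []; _∷_; _++_; [_]; reverse; map)
open import Data.List.Properties
  using (++-assoc; reverse-++; reverse-involutive; reverse-map; map-++; map-∘; map-id)
open import Data.Vec using (Vec; []; _∷_)
import Data.Vec as Vec
open import Data.Vec.Relation.Binary.Pointwise.Inductive as PW using (Pointwise)
open import Relation.Binary.Bundles using (Setoid)
open import Relation.Binary.Structures using (IsEquivalence)
import Relation.Binary.Construct.On as On
open import Relation.Binary.PropositionalEquality
  using (_≡_; refl; sym; trans; cong; cong₂; subst)

-- A letter of X ∪ X⁻¹ : (i , true) is x_i, (i , false) is x_i⁻¹.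
Letter : ℕ → Set
Letter n = Fin n × Bool

-- Words in the letters of X ∪ X⁻¹ (elements of F(X) are represented by
-- words; two words represent the same element of F(X) iff they are
-- freely equivalent, see _≃_).
Word : ℕ → Set
Word n = List (Letter n)

flipL : ∀ {n} → Letter n → Letter n
flipL (i , b) = (i , not b)

inv : ∀ {n} → Word n → Word n
inv w = reverse (map flipL w)

_* : ∀ {n} → Word n → Word n
a * = reverse a

infix 4 _≃_
data _≃_ {n : ℕ} : Word n → Word n → Set where
  ≃-refl   : ∀ {u} → u ≃ u
  ≃-sym    : ∀ {u v} → u ≃ v → v ≃ u
  ≃-trans  : ∀ {u v w} → u ≃ v → v ≃ w → u ≃ w
  ≃-cancel : ∀ (l : Letter n) → (l ∷ flipL l ∷ []) ≃ []
  ≃-ctx    : ∀ (a b : Word n) {p q} → p ≃ q → (a ++ p ++ b) ≃ (a ++ q ++ b)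

data InN {n : ℕ} (R : Word n → Set) : Word n → Set where
  N-gen  : ∀ {r} → R r → InN R r
  N-unit : InN R []
  N-mul  : ∀ {u v} → InN R u → InN R v → InN R (u ++ v)
  N-inv  : ∀ {u} → InN R u → InN R (inv u)
  N-conj : ∀ (w : Word n) {u} → InN R u → InN R (w ++ u ++ inv w)
  N-resp : ∀ {u v} → u ≃ v → InN R u → InN R v

-- equality in G = F(X)/N :  u = v in G  iff  u v⁻¹ ∈ N
_≈G[_]_ : ∀ {n} → Word n → (Word n → Set) → Word n → Set
u ≈G[ R ] v = InN R (u ++ inv v)

ReversibleRelations : ∀ {n} → (Word n → Set) → Set
ReversibleRelations {n} R = ∀ (r : Word n) → R r → InN R (r *)

private
  flipL-inv : ∀ {n} (l : Letter n) → flipL (flipL l) ≡ l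
  flipL-inv (i , b) = cong (i ,_) (not-involutive b)

  map-flip-flip : ∀ {n} (w : Word n) → map flipL (map flipL w) ≡ w
  map-flip-flip [] = refl
  map-flip-flip (l ∷ w) = cong₂ _∷_ (flipL-inv l) (map-flip-flip w)

inv-inv : ∀ {n} (w : Word n) → inv (inv w) ≡ w
inv-inv w =
  trans (cong reverse (reverse-map flipL (map flipL w)))
  (trans (reverse-involutive (map flipL (map flipL w))) (map-flip-flip w))

inv-++ : ∀ {n} (u v : Word n) → inv (u ++ v) ≡ inv v ++ inv u
inv-++ u v = trans (cong reverse (map-++ flipL u v))
                   (reverse-++ (map flipL u) (map flipL v))

inv-∷ : ∀ {n} (l : Letter n) (u : Word n) → inv (l ∷ u) ≡ inv u ++ [ flipL l ]
inv-∷ l u = inv-++ [ l ] u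

cancel-right : ∀ {n} (u : Word n) → (u ++ inv u) ≃ []
cancel-right [] = ≃-refl
cancel-right (l ∷ u) =
  subst (λ z → z ≃ []) (sym eq)
    (≃-trans (≃-ctx [ l ] [ flipL l ] (cancel-right u)) (≃-cancel l))
  where
  eq : (l ∷ u) ++ inv (l ∷ u) ≡ [ l ] ++ (u ++ inv u) ++ [ flipL l ]
  eq = cong (l ∷_) (trans (cong (u ++_) (inv-∷ l u))
                         (sym (++-assoc u (inv u) [ flipL l ])))

cancel-left : ∀ {n} (u : Word n) → (inv u ++ u) ≃ []
cancel-left u = subst (λ z → (inv u ++ z) ≃ []) (inv-inv u) (cancel-right (inv u))

≈G-refl : ∀ {n} {R : Word n → Set} {u} → u ≈G[ R ] u
≈G-refl {u = u} = N-resp (≃-sym (cancel-right u)) N-unit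

≈G-sym : ∀ {n} {R : Word n → Set} {u v} → u ≈G[ R ] v → v ≈G[ R ] u
≈G-sym {R = R} {u} {v} p =
  subst (InN R) (trans (inv-++ u (inv v)) (cong (_++ inv u) (inv-inv v))) (N-inv p)

≈G-trans : ∀ {n} {R : Word n → Set} {u v w} →
           u ≈G[ R ] v → v ≈G[ R ] w → u ≈G[ R ] w
≈G-trans {R = R} {u} {v} {w} p q = N-resp red (N-mul p q)
  where
  e1 : (u ++ inv v) ++ (v ++ inv w) ≡ u ++ (inv v ++ v) ++ inv w
  e1 = trans (++-assoc u (inv v) (v ++ inv w))
             (cong (u ++_) (sym (++-assoc (inv v) v (inv w))))
  red : ((u ++ inv v) ++ (v ++ inv w)) ≃ (u ++ inv w)
  red = subst (λ z → z ≃ (u ++ inv w)) (sym e1) (≃-ctx u (inv w) (cancel-left v))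

G-setoid : ∀ {n} → (Word n → Set) → Setoid _ _
G-setoid {n} R = record
  { Carrier = Word n
  ; _≈_ = λ u v → u ≈G[ R ] v
  ; isEquivalence = record
      { refl = λ {u} → ≈G-refl {R = R} {u}
      ; sym = λ {u} {v} → ≈G-sym {R = R} {u} {v}
      ; trans = λ {u} {v} {w} → ≈G-trans {R = R} {u} {v} {w} }
  }

Factorization : ℕ → ℕ → Set
Factorization n ℓ = Vec (Word n) ℓ

Factorization-setoid : ∀ {n} → (Word n → Set) → ℕ → Setoid _ _
Factorization-setoid R ℓ = PW.setoid (G-setoid R) ℓ

_≈F[_]_ : ∀ {n ℓ} → Factorization n ℓ → (Word n → Set) → Factorization n ℓ → Set
U ≈F[ R ] V = Setoid._≈_ (Factorization-setoid R _) U V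

data HurwitzStep {n : ℕ} : ∀ {ℓ} → Factorization n ℓ → Factorization n ℓ → Set where
  σ-here    : ∀ {ℓ} (x y : Word n) (W : Factorization n ℓ) →
              HurwitzStep (x ∷ y ∷ W) (y ∷ (inv y ++ x ++ y) ∷ W)
  σ⁻¹-here  : ∀ {ℓ} (x y : Word n) (W : Factorization n ℓ) →
              HurwitzStep (x ∷ y ∷ W) ((x ++ y ++ inv x) ∷ x ∷ W)
  there     : ∀ {ℓ} (x : Word n) {W W' : Factorization n ℓ} →
              HurwitzStep W W' → HurwitzStep (x ∷ W) (x ∷ W')

data InOrbit {n : ℕ} (R : Word n → Set) {ℓ} (U : Factorization n ℓ) :
             Factorization n ℓ → Set where
  start : ∀ {W} → U ≈F[ R ] W → InOrbit R U W
  step  : ∀ {W W'} → InOrbit R U W → HurwitzStep W W' → InOrbit R U W'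

HurwitzOrbit : ∀ {n ℓ} (R : Word n → Set) → Factorization n ℓ → Setoid _ _
HurwitzOrbit {n} {ℓ} R U =
  On.setoid (Factorization-setoid R ℓ)
            (proj₁ {B = InOrbit R U})

DoubleReverses : ∀ {n ℓ} (R : Word n → Set) → Factorization n ℓ → Factorization n ℓ → Set
DoubleReverses {n} {ℓ} R U V =
  Σ (Vec (Word n) ℓ) λ a →
    (U ≈F[ R ] a) × (V ≈F[ R ] Vec.reverse (Vec.map _* a))

-- Reversal a ↦ a* is an anti-automorphism of F(X) (it fixes the generators and
-- reverses products); reversible relations make N closed under it, so it
-- descends to an anti-automorphism of G. Reversing a factorization entrywise
-- and reversing the order of its entries turns σ_i into σ_{ℓ-i}⁻¹ and σ_i⁻¹
-- into σ_{ℓ-i}, so this involution maps the Hurwitz orbit of U onto that of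
-- its double reverse V and back.
module Submission where

open import Defs
open import Data.Nat using (ℕ)
open import Data.Bool.Properties using (not-involutive)
open import Data.Product using (_,_)
open import Data.List using ([]; _∷_; _++_; reverse; map)
open import Data.List.Properties
  using (++-assoc; ++-identityʳ; reverse-++; reverse-involutive; reverse-map)
open import Data.Vec using (Vec; []; _∷_; _∷ʳ_)
import Data.Vec as Vec
import Data.Vec.Properties as Vec
open import Data.Vec.Relation.Binary.Pointwise.Inductive using (Pointwise; []; _∷_)
open import Function.Bundles using (Bijection; Inverse)
open import Function.Properties.Inverse using (Inverse⇒Bijection)
open import Relation.Binary.Bundles using (Setoid)
open import Relation.Binary.Core using (REL)
open import Relation.Binary.PropositionalEquality
  using (_≡_; refl; sym; trans; cong; cong₂; subst; subst₂)

private
  variable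
    n ℓ : ℕ

flipL-involutive : (l : Letter n) → flipL (flipL l) ≡ l
flipL-involutive (i , b) = cong (i ,_) (not-involutive b)

*-++³ : (a p b : Word n) → (a ++ p ++ b) * ≡ b * ++ p * ++ a *
*-++³ a p b = trans (reverse-++ a (p ++ b))
  (trans (cong (_++ reverse a) (reverse-++ p b))
         (++-assoc (reverse b) (reverse p) (reverse a)))

inv-* : (u : Word n) → inv u * ≡ inv (u *)
inv-* u = trans (reverse-involutive (map flipL u))
  (sym (trans (cong reverse (reverse-map flipL u))
              (reverse-involutive (map flipL u))))

*-resp-≃ : {u v : Word n} → u ≃ v → u * ≃ v *
*-resp-≃ ≃-refl          = ≃-refl
*-resp-≃ (≃-sym e)       = ≃-sym (*-resp-≃ e)
*-resp-≃ (≃-trans e f)   = ≃-trans (*-resp-≃ e) (*-resp-≃ f)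
*-resp-≃ (≃-cancel l)    =
  subst (λ l′ → (flipL l ∷ l′ ∷ []) ≃ []) (flipL-involutive l) (≃-cancel (flipL l))
*-resp-≃ (≃-ctx a b {p} {q} e) =
  subst₂ _≃_ (sym (*-++³ a p b)) (sym (*-++³ a q b)) (≃-ctx (b *) (a *) (*-resp-≃ e))

InN-rotate : {R : Word n → Set} (x y : Word n) → InN R (x ++ y) → InN R (y ++ x)
InN-rotate {R = R} x y p = N-resp cancel (subst (InN R) regroup (N-conj y p))
  where
  regroup : y ++ (x ++ y) ++ inv y ≡ (y ++ x) ++ (y ++ inv y) ++ []
  regroup = trans (sym (++-assoc y (x ++ y) (inv y)))
    (trans (cong (_++ inv y) (sym (++-assoc y x y)))
    (trans (++-assoc (y ++ x) y (inv y))
           (cong ((y ++ x) ++_) (sym (++-identityʳ (y ++ inv y))))))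
  cancel : ((y ++ x) ++ (y ++ inv y) ++ []) ≃ (y ++ x)
  cancel = subst ((y ++ x) ++ (y ++ inv y) ++ [] ≃_) (++-identityʳ (y ++ x))
    (≃-ctx (y ++ x) [] (cancel-right y))

module _ {R : Word n → Set} (rev : ReversibleRelations R) where

  InN-* : {u : Word n} → InN R u → InN R (u *)
  InN-* (N-gen {r} r∈R) = rev r r∈R
  InN-* N-unit = N-unit
  InN-* (N-mul {u} {v} p q) =
    subst (InN R) (sym (reverse-++ u v)) (N-mul (InN-* q) (InN-* p))
  InN-* (N-inv {u} p) = subst (InN R) (sym (inv-* u)) (N-inv (InN-* p))
  InN-* (N-conj w {u} p) = subst (InN R) conj (N-conj (inv (w *)) (InN-* p))
    where
    conj : inv (w *) ++ u * ++ inv (inv (w *)) ≡ (w ++ u ++ inv w) *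
    conj = sym (trans (*-++³ w u (inv w))
      (cong₂ (λ s t → s ++ u * ++ t) (inv-* w) (sym (inv-inv (w *)))))
  InN-* (N-resp e p) = N-resp (*-resp-≃ e) (InN-* p)

  -- (u v⁻¹)* = (v*)⁻¹ u*, a cyclic rotation of u* (v*)⁻¹.
  *-resp-≈G : {u v : Word n} → u ≈G[ R ] v → (u *) ≈G[ R ] (v *)
  *-resp-≈G {u} {v} p = InN-rotate (inv (v *)) (u *)
    (subst (InN R) (trans (reverse-++ u (inv v)) (cong (_++ u *) (inv-* v))) (InN-* p))

reverse* : Factorization n ℓ → Factorization n ℓ
reverse* []      = []
reverse* (x ∷ W) = reverse* W ∷ʳ x *

reverse*-∷ʳ : (W : Factorization n ℓ) (x : Word n) →
              reverse* (W ∷ʳ x) ≡ x * ∷ reverse* W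
reverse*-∷ʳ []      x = refl
reverse*-∷ʳ (y ∷ W) x = cong (_∷ʳ y *) (reverse*-∷ʳ W x)

reverse*-involutive : (W : Factorization n ℓ) → reverse* (reverse* W) ≡ W
reverse*-involutive []      = refl
reverse*-involutive (x ∷ W) = trans (reverse*-∷ʳ (reverse* W) (x *))
  (cong₂ _∷_ (reverse-involutive x) (reverse*-involutive W))

reverse*≡reverse∘map* : (W : Factorization n ℓ) → Vec.reverse (Vec.map _* W) ≡ reverse* W
reverse*≡reverse∘map* []      = refl
reverse*≡reverse∘map* (x ∷ W) =
  trans (Vec.reverse-∷ (x *) (Vec.map _* W)) (cong (_∷ʳ x *) (reverse*≡reverse∘map* W))

Pointwise-∷ʳ⁺ : ∀ {a b r} {A : Set a} {B : Set b} {_∼_ : REL A B r}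
                {xs : Vec A ℓ} {ys : Vec B ℓ} {x y} →
                Pointwise _∼_ xs ys → x ∼ y → Pointwise _∼_ (xs ∷ʳ x) (ys ∷ʳ y)
Pointwise-∷ʳ⁺ []         x∼y = x∼y ∷ []
Pointwise-∷ʳ⁺ (p ∷ ps)   x∼y = p ∷ Pointwise-∷ʳ⁺ ps x∼y

module _ {R : Word n → Set} where

  private
    module ≈F {ℓ} = Setoid (Factorization-setoid R ℓ)

  reverse*-cong : ReversibleRelations R → {W W′ : Factorization n ℓ} →
                  W ≈F[ R ] W′ → reverse* W ≈F[ R ] reverse* W′
  reverse*-cong rev [] = []
  reverse*-cong rev (_∷_ {x = x} {y = y} p ps) =
    Pointwise-∷ʳ⁺ (reverse*-cong rev ps) (*-resp-≈G rev {x} {y} p)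

  DoubleReverses⇒≈reverse* : ReversibleRelations R → {U V : Factorization n ℓ} →
                             DoubleReverses R U V → V ≈F[ R ] reverse* U
  DoubleReverses⇒≈reverse* rev (a , U≈a , V≈a*) =
    ≈F.trans V≈a* (≈F.trans (≈F.reflexive (reverse*≡reverse∘map* a))
                            (reverse*-cong rev (≈F.sym U≈a)))

  DoubleReverses-sym : {U V : Factorization n ℓ} → DoubleReverses R U V → DoubleReverses R V U
  DoubleReverses-sym (a , U≈a , V≈a*) =
    a* , V≈a* , ≈F.trans U≈a (≈F.reflexive (sym a**≡a))
    where
    a* : Factorization n _
    a* = Vec.reverse (Vec.map _* a)
    a**≡a : Vec.reverse (Vec.map _* a*) ≡ a
    a**≡a = trans (reverse*≡reverse∘map* a*)
      (trans (cong reverse* (reverse*≡reverse∘map* a)) (reverse*-involutive a))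

HurwitzStep-∷ʳ : {S T : Factorization n ℓ} (z : Word n) →
                 HurwitzStep S T → HurwitzStep (S ∷ʳ z) (T ∷ʳ z)
HurwitzStep-∷ʳ z (σ-here x y W)   = σ-here x y (W ∷ʳ z)
HurwitzStep-∷ʳ z (σ⁻¹-here x y W) = σ⁻¹-here x y (W ∷ʳ z)
HurwitzStep-∷ʳ z (there x s)      = there x (HurwitzStep-∷ʳ z s)

HurwitzStep-atEnd : (W : Factorization n ℓ) {a b c d : Word n} →
                    HurwitzStep (a ∷ b ∷ []) (c ∷ d ∷ []) →
                    HurwitzStep (W ∷ʳ a ∷ʳ b) (W ∷ʳ c ∷ʳ d)
HurwitzStep-atEnd []      s = s
HurwitzStep-atEnd (w ∷ W) s = there w (HurwitzStep-atEnd W s)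

reverse*-HurwitzStep : {S T : Factorization n ℓ} →
                       HurwitzStep S T → HurwitzStep (reverse* S) (reverse* T)
reverse*-HurwitzStep (σ-here x y W) = HurwitzStep-atEnd (reverse* W)
  (subst (λ t → HurwitzStep (y * ∷ x * ∷ []) (t ∷ y * ∷ [])) conj (σ⁻¹-here (y *) (x *) []))
  where
  conj : y * ++ x * ++ inv (y *) ≡ (inv y ++ x ++ y) *
  conj = sym (trans (*-++³ (inv y) x y) (cong (λ t → y * ++ x * ++ t) (inv-* y)))
reverse*-HurwitzStep (σ⁻¹-here x y W) = HurwitzStep-atEnd (reverse* W)
  (subst (λ t → HurwitzStep (y * ∷ x * ∷ []) (x * ∷ t ∷ [])) conj (σ-here (y *) (x *) []))
  where
  conj : inv (x *) ++ y * ++ x * ≡ (x ++ y ++ inv x) *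
  conj = sym (trans (*-++³ x y (inv x)) (cong (_++ y * ++ x *) (inv-* x)))
reverse*-HurwitzStep (there x s) = HurwitzStep-∷ʳ (x *) (reverse*-HurwitzStep s)

module _ {R : Word n → Set} (rev : ReversibleRelations R) where

  private
    module ≈F {ℓ} = Setoid (Factorization-setoid R ℓ)

  reverse*-InOrbit : {U V W : Factorization n ℓ} → V ≈F[ R ] reverse* U →
                     InOrbit R U W → InOrbit R V (reverse* W)
  reverse*-InOrbit V≈U* (start U≈W) = start (≈F.trans V≈U* (reverse*-cong rev U≈W))
  reverse*-InOrbit V≈U* (step o s)  = step (reverse*-InOrbit V≈U* o) (reverse*-HurwitzStep s)

  reverse*-orbitInverse : {U V : Factorization n ℓ} →
                          V ≈F[ R ] reverse* U → U ≈F[ R ] reverse* V →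
                          Inverse (HurwitzOrbit R U) (HurwitzOrbit R V)
  reverse*-orbitInverse V≈U* U≈V* = record
    { to        = λ (W , o) → reverse* W , reverse*-InOrbit V≈U* o
    ; from      = λ (W , o) → reverse* W , reverse*-InOrbit U≈V* o
    ; to-cong   = reverse*-cong rev
    ; from-cong = reverse*-cong rev
    ; inverse   = cancel , cancel
    }
    where
    cancel : {W W′ : Factorization n _} → W′ ≈F[ R ] reverse* W → reverse* W′ ≈F[ R ] W
    cancel {W} p = ≈F.trans (reverse*-cong rev p) (≈F.reflexive (reverse*-involutive W))

theorem6p6 : (n : ℕ) (R : Word n → Set) → ReversibleRelations R →
    (ℓ : ℕ) (U V : Factorization n ℓ) → DoubleReverses R U V →
    Bijection (HurwitzOrbit R U) (HurwitzOrbit R V)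
theorem6p6 n R rev ℓ U V UV = Inverse⇒Bijection (reverse*-orbitInverse rev
  (DoubleReverses⇒≈reverse* rev UV)
  (DoubleReverses⇒≈reverse* rev (DoubleReverses-sym UV)))
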